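{- Let $A\in\mathbb{Z}^{n\times d}$ have rank $r$, let $c_1,\dots,c_d$ be positive integers, and let $K,K'\in\mathbb{Z}^{d\times(d-r)}$ be bases of the integer kernels of $A$ and of $A':=A\cdot\mathrm{diag}(c_1,\dots,c_d)$, respectively. For every $i\in[1,d]$: (1) if $\gcd(K[i])=0$ then $\gcd(K'[i])=0$; and (2) if $\gcd(K[i])>0$ then $\gcd(K'[i])\ne0$ and $\gcd(K'[i])$ divides $\mathrm{lcm}(c_1,\dots,c_d)\cdot\gcd(K[i])$.
   Context: The integer kernel of a matrix $M\in\mathbb{Z}^{n\times d}$ is $\ker(M)=\{\vec v\in\mathbb{Z}^d:M\vec v=\vec 0\}$; a basis of it is a matrix $K\in\mathbb{Z}^{d\times(d-r)}$, $r=\mathrm{rank}(M)$, with $\ker(M)=\{K\vec v:\vec v\in\mathbb{Z}^{d-r}\}$. $K[i]$ denotes the $i$-th row of $K$, and $\gcd(K[i])$ the non-negative gcd of its entries (which is $0$ iff the row is zero). $\mathrm{diag}(c_1,\dots,c_d)$ is the diagonal matrix with $c_1,\dots,c_d$ on the diagonal. -}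

module Defs where

open import Data.Nat as ℕ using (ℕ; zero; suc)
open import Data.Nat.LCM as ℕL using ()
open import Data.Nat.GCD as ℕG using ()
open import Data.Integer as ℤ using (ℤ; +_; _+_; _*_; -_)
open import Data.Integer.GCD as ℤG using ()
open import Data.Fin as Fin using (Fin; punchIn)
open import Data.Fin.Base using (_<_)
open import Data.Product using (Σ; ∃; _×_; _,_)
open import Relation.Binary.PropositionalEquality using (_≡_)
open import Relation.Nullary using (¬_)
open import Function.Bundles using (_⇔_)

Mat : ℕ → ℕ → Set
Mat m n = Fin m → Fin n → ℤ

ZVec : ℕ → Set
ZVec n = Fin n → ℤ

∑ : ∀ {n} → (Fin n → ℤ) → ℤ
∑ {zero}  f = + 0
∑ {suc n} f = f Fin.zero + ∑ (λ i → f (Fin.suc i))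

_·ᵥ_ : ∀ {m n} → Mat m n → ZVec n → ZVec m
(M ·ᵥ v) i = ∑ (λ j → M i j * v j)

_·ₘ_ : ∀ {m n p} → Mat m n → Mat n p → Mat m p
(M ·ₘ N) i k = ∑ (λ j → M i j * N j k)

diag : ∀ {d} → (Fin d → ℕ) → Mat d d
diag c i j with i Fin.≟ j
... | Relation.Nullary.yes _ = + c i
... | Relation.Nullary.no  _ = + 0

sgn : ℕ → ℤ
sgn zero          = + 1
sgn (suc zero)    = ℤ.-[1+ 0 ]
sgn (suc (suc k)) = sgn k

det : ∀ {k} → Mat k k → ℤ
det {zero}  M = + 1
det {suc k} M = ∑ (λ j → sgn (Fin.toℕ j) * (M Fin.zero j * det (λ a b → M (Fin.suc a) (punchIn j b))))

Increasing : ∀ {k n} → (Fin k → Fin n) → Set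
Increasing s = ∀ a b → a < b → s a < s b

minor : ∀ {m n k} → Mat m n → (Fin k → Fin m) → (Fin k → Fin n) → ℤ
minor M ρ κ = det (λ a b → M (ρ a) (κ b))

HasNonzeroMinor : ∀ {m n} → Mat m n → ℕ → Set
HasNonzeroMinor {m} {n} M k =
  Σ (Fin k → Fin m) λ ρ → Σ (Fin k → Fin n) λ κ →
    Increasing ρ × Increasing κ × ¬ (minor M ρ κ ≡ + 0)

HasRank : ∀ {m n} → Mat m n → ℕ → Set
HasRank M r = HasNonzeroMinor M r × ¬ HasNonzeroMinor M (suc r)

IsKernelBasis : ∀ {m d k} → Mat m d → Mat d k → Set
IsKernelBasis {d = d} {k = k} M K =
  ∀ (v : ZVec d) → ((∀ i → (M ·ᵥ v) i ≡ + 0) ⇔ Σ (ZVec k) λ w → ∀ j → v j ≡ (K ·ᵥ w) j)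

-- non-negative gcd of the entries of a vector (0 iff the vector is zero)
gcdᵥ : ∀ {k} → ZVec k → ℕ
gcdᵥ {zero}  v = 0
gcdᵥ {suc k} v = ℕG.gcd ℤ.∣ v Fin.zero ∣ (gcdᵥ (λ i → v (Fin.suc i)))

lcmᵥ : ∀ {d} → (Fin d → ℕ) → ℕ
lcmᵥ {zero}  c = 1
lcmᵥ {suc d} c = ℕL.lcm (c Fin.zero) (lcmᵥ (λ i → c (Fin.suc i)))

{-# OPTIONS --safe #-}
-- Scaling the columns of A by c turns the kernel condition into
-- A'v = 0 ⇔ A(c ⊙ v) = 0. Moreover gcd(K[i]) generates the ideal of i-th
-- coordinates of kernel vectors, since every kernel vector is an integer
-- combination of the columns of K. Hence c_i K'[i] consists of i-th coordinates
-- of ker A, which gives (1); and for each column u of K the vector with entries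
-- (lcm c / c_k) u_k lies in ker A', so gcd(K'[i]) divides (lcm c / c_i) K[i],
-- which gives the divisibility in (2); as lcm c ≠ 0, it also forces gcd(K'[i]) ≠ 0.
module Submission where

open import Defs
open import Data.Nat using (ℕ; _∸_; _*_; NonZero)
open import Data.Nat.Divisibility using (_∣_)
open import Data.Fin using (Fin)
open import Data.Integer using (+_)
open import Data.Product using (_×_)
open import Relation.Binary.PropositionalEquality using (_≡_)
open import Relation.Nullary using (¬_)

import Data.Nat as ℕ
import Data.Nat.Properties as ℕ
import Data.Nat.Divisibility as ℕ
import Data.Nat.GCD as ℕ
import Data.Nat.LCM as ℕ
import Data.Integer as ℤ
import Data.Integer.Properties as ℤ
import Data.Integer.Divisibility.Signed as ℤ
import Data.Fin as Fin
import Data.Fin.Properties as Fin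
open import Data.Integer.Tactic.RingSolver using (solve-∀)
open import Data.Product using (_,_)
open import Data.Empty using (⊥-elim)
open import Relation.Nullary using (yes; no)
open import Relation.Binary.PropositionalEquality
  using (refl; sym; trans; cong; cong₂; subst; _≢_; module ≡-Reasoning)
open import Function.Bundles using (Equivalence)

private
  variable
    m n d k : ℕ

∑-cong : {f g : Fin n → ℤ.ℤ} → (∀ j → f j ≡ g j) → ∑ f ≡ ∑ g
∑-cong {ℕ.zero}  f≗g = refl
∑-cong {ℕ.suc n} f≗g = cong₂ ℤ._+_ (f≗g Fin.zero) (∑-cong (λ j → f≗g (Fin.suc j)))

∑-zero : (f : Fin n → ℤ.ℤ) → (∀ j → f j ≡ + 0) → ∑ f ≡ + 0
∑-zero {ℕ.zero}  f f≗0 = refl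
∑-zero {ℕ.suc n} f f≗0 =
  cong₂ ℤ._+_ (f≗0 Fin.zero) (∑-zero (λ j → f (Fin.suc j)) (λ j → f≗0 (Fin.suc j)))

∑-single : (j : Fin n) (f : Fin n → ℤ.ℤ) → (∀ l → l ≢ j → f l ≡ + 0) → ∑ f ≡ f j
∑-single {ℕ.suc n} Fin.zero f f≗0 =
  trans (cong (λ s → f Fin.zero ℤ.+ s) (∑-zero _ (λ l → f≗0 (Fin.suc l) (λ ())))) (ℤ.+-identityʳ _)
∑-single {ℕ.suc n} (Fin.suc j) f f≗0 =
  trans (cong (ℤ._+ ∑ (λ l → f (Fin.suc l))) (f≗0 Fin.zero (λ ())))
        (trans (ℤ.+-identityˡ _)
               (∑-single j (λ l → f (Fin.suc l))
                          (λ l l≢j → f≗0 (Fin.suc l) (λ e → l≢j (Fin.suc-injective e)))))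

∑-*ˡ : (a : ℤ.ℤ) (f : Fin n → ℤ.ℤ) → ∑ (λ j → a ℤ.* f j) ≡ a ℤ.* ∑ f
∑-*ˡ {ℕ.zero}  a f = sym (ℤ.*-zeroʳ a)
∑-*ˡ {ℕ.suc n} a f =
  trans (cong (λ s → a ℤ.* f Fin.zero ℤ.+ s) (∑-*ˡ a (λ j → f (Fin.suc j))))
        (sym (ℤ.*-distribˡ-+ a (f Fin.zero) _))

∣-∑ : (x : ℤ.ℤ) (f : Fin n → ℤ.ℤ) → (∀ j → x ℤ.∣ f j) → x ℤ.∣ ∑ f
∣-∑ {ℕ.zero}  x f x∣f = ℤ.∣ᵤ⇒∣ (ℤ.∣ x ∣ ℕ.∣0)
∣-∑ {ℕ.suc n} x f x∣f =
  ℤ.∣m∣n⇒∣m+n (x∣f Fin.zero) (∣-∑ x (λ j → f (Fin.suc j)) (λ j → x∣f (Fin.suc j)))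

diag-≡ : (c : Fin d → ℕ) (j : Fin d) → diag c j j ≡ + c j
diag-≡ c j with j Fin.≟ j
... | yes _   = refl
... | no j≢j = ⊥-elim (j≢j refl)

diag-≢ : (c : Fin d → ℕ) {l j : Fin d} → l ≢ j → diag c l j ≡ + 0
diag-≢ c {l} {j} l≢j with l Fin.≟ j
... | yes l≡j = ⊥-elim (l≢j l≡j)
... | no _    = refl

·ᵥ-diagColumn : (M : Mat m d) (c : Fin d → ℕ) (j : Fin d) (i : Fin m) →
                (M ·ᵥ (λ l → diag c l j)) i ≡ M i j ℤ.* + c j
·ᵥ-diagColumn M c j i =
  trans (∑-single j (λ l → M i l ℤ.* diag c l j)
                    (λ l l≢j → trans (cong (M i l ℤ.*_) (diag-≢ c l≢j)) (ℤ.*-zeroʳ (M i l))))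
        (cong (M i j ℤ.*_) (diag-≡ c j))

_⊙_ : (Fin d → ℕ) → ZVec d → ZVec d
(c ⊙ v) l = + c l ℤ.* v l

·ₘdiag-·ᵥ : (A : Mat n d) (c : Fin d → ℕ) (v : ZVec d) (i : Fin n) →
            ((A ·ₘ diag c) ·ᵥ v) i ≡ (A ·ᵥ (c ⊙ v)) i
·ₘdiag-·ᵥ A c v i = ∑-cong λ j →
  trans (cong (ℤ._* v j) (·ᵥ-diagColumn A c j i)) (ℤ.*-assoc (A i j) (+ c j) (v j))

_∈ker_ : ZVec d → Mat m d → Set
v ∈ker M = ∀ i → (M ·ᵥ v) i ≡ + 0

∈ker-·ₘdiag⇒ : (A : Mat n d) (c : Fin d → ℕ) {v : ZVec d} →
               v ∈ker (A ·ₘ diag c) → (c ⊙ v) ∈ker A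
∈ker-·ₘdiag⇒ A c {v} Av≡0 i = trans (sym (·ₘdiag-·ᵥ A c v i)) (Av≡0 i)

∈ker-·ₘdiag⇐ : (A : Mat n d) (c q : Fin d → ℕ) (L : ℕ) → (∀ l → c l * q l ≡ L) →
               {u : ZVec d} → u ∈ker A → (q ⊙ u) ∈ker (A ·ₘ diag c)
∈ker-·ₘdiag⇐ A c q L cq≡L {u} Au≡0 i = begin
  ((A ·ₘ diag c) ·ᵥ (q ⊙ u)) i          ≡⟨ ·ₘdiag-·ᵥ A c (q ⊙ u) i ⟩
  ∑ (λ l → A i l ℤ.* (c ⊙ (q ⊙ u)) l)  ≡⟨ ∑-cong entry ⟩
  ∑ (λ l → + L ℤ.* (A i l ℤ.* u l))     ≡⟨ ∑-*ˡ (+ L) (λ l → A i l ℤ.* u l) ⟩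
  + L ℤ.* (A ·ᵥ u) i                     ≡⟨ cong (+ L ℤ.*_) (Au≡0 i) ⟩
  + L ℤ.* + 0                            ≡⟨ ℤ.*-zeroʳ (+ L) ⟩
  + 0                                    ∎
  where
  open ≡-Reasoning
  rearrange : ∀ a x y w → a ℤ.* (x ℤ.* (y ℤ.* w)) ≡ (x ℤ.* y) ℤ.* (a ℤ.* w)
  rearrange = solve-∀
  entry : ∀ l → A i l ℤ.* (c ⊙ (q ⊙ u)) l ≡ + L ℤ.* (A i l ℤ.* u l)
  entry l = trans (rearrange (A i l) (+ c l) (+ q l) (u l))
                  (cong (ℤ._* (A i l ℤ.* u l)) (trans (sym (ℤ.pos-* (c l) (q l))) (cong +_ (cq≡L l))))

gcdᵥ-∣ : (v : ZVec k) (j : Fin k) → gcdᵥ v ∣ ℤ.∣ v j ∣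
gcdᵥ-∣ v Fin.zero    = ℕ.gcd[m,n]∣m _ _
gcdᵥ-∣ v (Fin.suc j) =
  ℕ.∣-trans (ℕ.gcd[m,n]∣n ℤ.∣ v Fin.zero ∣ _) (gcdᵥ-∣ (λ l → v (Fin.suc l)) j)

∣-*gcdᵥ : (q : ℕ) (v : ZVec k) {x : ℕ} → (∀ j → x ∣ q * ℤ.∣ v j ∣) → x ∣ q * gcdᵥ v
∣-*gcdᵥ {ℕ.zero}  q v x∣qv rewrite ℕ.*-zeroʳ q = _ ℕ.∣0
∣-*gcdᵥ {ℕ.suc k} q v x∣qv
  rewrite ℕ.c*gcd[m,n]≡gcd[cm,cn] q ℤ.∣ v Fin.zero ∣ (gcdᵥ (λ l → v (Fin.suc l))) =
  ℕ.gcd-greatest (x∣qv Fin.zero) (∣-*gcdᵥ q (λ l → v (Fin.suc l)) (λ j → x∣qv (Fin.suc j)))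

gcdᵥ-zero : (v : ZVec k) → (∀ j → v j ≡ + 0) → gcdᵥ v ≡ 0
gcdᵥ-zero {ℕ.zero}  v v≗0 = refl
gcdᵥ-zero {ℕ.suc k} v v≗0
  rewrite v≗0 Fin.zero | gcdᵥ-zero (λ l → v (Fin.suc l)) (λ j → v≗0 (Fin.suc j)) = refl

gcdᵥ-∣-∑ : (v w : ZVec k) → gcdᵥ v ∣ ℤ.∣ ∑ (λ j → v j ℤ.* w j) ∣
gcdᵥ-∣-∑ v w = ℤ.∣⇒∣ᵤ (∣-∑ (+ gcdᵥ v) _ (λ j → ℤ.∣m⇒∣m*n {m = v j} (w j) (ℤ.∣ᵤ⇒∣ (gcdᵥ-∣ v j))))

lcmᵥ-∣ : (c : Fin d → ℕ) (j : Fin d) → c j ∣ lcmᵥ c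
lcmᵥ-∣ c Fin.zero    = ℕ.m∣lcm[m,n] _ _
lcmᵥ-∣ c (Fin.suc j) = ℕ.∣-trans (lcmᵥ-∣ (λ l → c (Fin.suc l)) j) (ℕ.n∣lcm[m,n] (c Fin.zero) _)

lcm-nonZero : ∀ a b → .{{NonZero a}} → .{{NonZero b}} → NonZero (ℕ.lcm a b)
lcm-nonZero a b = ℕ.m*n≢0⇒n≢0 (ℕ.gcd a b) {{subst NonZero (sym (ℕ.gcd*lcm a b)) (ℕ.m*n≢0 a b)}}

lcmᵥ-nonZero : (c : Fin d → ℕ) → (∀ l → NonZero (c l)) → NonZero (lcmᵥ c)
lcmᵥ-nonZero {ℕ.zero}  c c≢0 = _
lcmᵥ-nonZero {ℕ.suc d} c c≢0 =
  lcm-nonZero _ _ {{c≢0 Fin.zero}} {{lcmᵥ-nonZero (λ l → c (Fin.suc l)) (λ l → c≢0 (Fin.suc l))}}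

module _ (M : Mat m d) (K : Mat d k) (basis : IsKernelBasis M K) where

  kernelBasis-column∈ker : (j : Fin k) → (λ l → K l j) ∈ker M
  kernelBasis-column∈ker j = Equivalence.from (basis _) ((λ l → diag (λ _ → 1) l j) , λ l →
    sym (trans (·ᵥ-diagColumn K (λ _ → 1) j l) (ℤ.*-identityʳ (K l j))))

  kernelBasis-gcdᵥ-∣ : (i : Fin d) {v : ZVec d} → v ∈ker M → gcdᵥ (K i) ∣ ℤ.∣ v i ∣
  kernelBasis-gcdᵥ-∣ i v∈ker with Equivalence.to (basis _) v∈ker
  ... | w , v≡Kw = subst (λ x → gcdᵥ (K i) ∣ ℤ.∣ x ∣) (sym (v≡Kw i)) (gcdᵥ-∣-∑ (K i) w)

  kernelBasis-gcdᵥ≡0 : (i : Fin d) → gcdᵥ (K i) ≡ 0 → {v : ZVec d} → v ∈ker M → v i ≡ + 0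
  kernelBasis-gcdᵥ≡0 i g≡0 v∈ker =
    ℤ.∣i∣≡0⇒i≡0 (ℕ.0∣⇒≡0 (subst (_∣ _) g≡0 (kernelBasis-gcdᵥ-∣ i v∈ker)))

lemma34 : (n d r : ℕ) (A : Mat n d) → HasRank A r →
          (c : Fin d → ℕ) → (∀ i → NonZero (c i)) →
          (K K′ : Mat d (d ∸ r)) →
          IsKernelBasis A K → IsKernelBasis (A ·ₘ diag c) K′ →
          (i : Fin d) →
            (gcdᵥ (K i) ≡ 0 → gcdᵥ (K′ i) ≡ 0)
            × (¬ (gcdᵥ (K i) ≡ 0) → ¬ (gcdᵥ (K′ i) ≡ 0) × (gcdᵥ (K′ i) ∣ lcmᵥ c * gcdᵥ (K i)))
lemma34 n d r A _ c c≢0 K K′ basis basis′ i =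
  (λ g≡0 → gcdᵥ-zero (K′ i) (K′[i]≡0 g≡0)) ,
  (λ g≢0 → (λ g′≡0 → g≢0 (L*g≡0⇒g≡0 (ℕ.0∣⇒≡0 (subst (_∣ _) g′≡0 g′∣L*g)))) , g′∣L*g)
  where
  L = lcmᵥ c
  q : Fin d → ℕ
  q l = ℕ._∣_.quotient (lcmᵥ-∣ c l)
  cq≡L : ∀ l → c l * q l ≡ L
  cq≡L l = trans (ℕ.*-comm (c l) (q l)) (sym (ℕ._∣_.equality (lcmᵥ-∣ c l)))

  K′[i]≡0 : gcdᵥ (K i) ≡ 0 → ∀ j → K′ i j ≡ + 0
  K′[i]≡0 g≡0 j = ℤ.*-cancelˡ-≡ (+ c i) (K′ i j) (+ 0) {{c≢0 i}}
    (trans (kernelBasis-gcdᵥ≡0 A K basis i g≡0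
             (∈ker-·ₘdiag⇒ A c (kernelBasis-column∈ker (A ·ₘ diag c) K′ basis′ j)))
           (sym (ℤ.*-zeroʳ (+ c i))))

  g′∣L*g : gcdᵥ (K′ i) ∣ L * gcdᵥ (K i)
  g′∣L*g = ℕ.∣-trans (∣-*gcdᵥ (q i) (K i) λ j →
             subst (gcdᵥ (K′ i) ∣_) (ℤ.abs-* (+ q i) (K i j))
               (kernelBasis-gcdᵥ-∣ (A ·ₘ diag c) K′ basis′ i
                 (∈ker-·ₘdiag⇐ A c q L cq≡L (kernelBasis-column∈ker A K basis j))))
           (ℕ.*-monoˡ-∣ (gcdᵥ (K i)) (ℕ.divides (c i) (sym (cq≡L i))))

  L*g≡0⇒g≡0 : L * gcdᵥ (K i) ≡ 0 → gcdᵥ (K i) ≡ 0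
  L*g≡0⇒g≡0 L*g≡0 =
    ℕ.m*n≡0⇒m≡0 _ L {{lcmᵥ-nonZero c c≢0}} (trans (ℕ.*-comm (gcdᵥ (K i)) L) L*g≡0)
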